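{- Let $G$ be a graph with $n$ vertices and treewidth at most $w$, with two designated terminal vertices. Then $G$ can be reduced (transformed until only the two terminals remain, joined by at most a single edge) using $O(w^2 n)$ parallel reductions and $O(n)$ star-mesh transformations, each of degree at most $w+1$, where no terminal vertex is ever deleted.
   Context: A parallel reduction replaces two parallel edges between the same pair of vertices by a single edge. A $k$-star-mesh transformation (of degree $k$) deletes a vertex $c$ of degree $k$ with neighbors $v_1,\dots,v_k$ together with its incident edges, and adds an edge $v_iv_j$ for every pair $i<j$ (this may create parallel edges). Terminals may not be deleted by a star-mesh transformation. -}

module Defs where

open import Data.Nat using (ℕ; zero; suc; _+_; _≤_)
open import Data.Fin using (Fin)
open import Data.Fin.Subset as Sub using (Subset; ∣_∣)
open import Data.List using (List; []; _∷_; _++_; map; length)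
open import Data.List.Membership.Propositional using (_∈_)
open import Data.List.Relation.Unary.All using (All)
open import Data.List.Relation.Unary.AllPairs using (AllPairs)
open import Data.List.Relation.Unary.Unique.Propositional using (Unique)
open import Data.List.Relation.Binary.Pointwise using (Pointwise)
open import Data.List.Relation.Binary.Permutation.Propositional using (_↭_)
open import Data.Product using (Σ; ∃; _×_; _,_; proj₁; proj₂)
open import Data.Sum using (_⊎_)
open import Relation.Binary.PropositionalEquality using (_≡_; _≢_)
open import Relation.Nullary using (¬_)
open import Data.Unit using (⊤)

-- Multigraphs on the vertex set Fin n: an edge is an (unordered) pair,
-- represented by an ordered pair; the edge multiset is a list
-- (considered up to permutation).

Edge : ℕ → Set
Edge n = Fin n × Fin n

SameEnds : ∀ {n} → Edge n → Edge n → Set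
SameEnds (a , b) (c , d) = (a ≡ c × b ≡ d) ⊎ (a ≡ d × b ≡ c)

SimpleGraph : ∀ {n} → List (Edge n) → Set
SimpleGraph E = All (λ e → proj₁ e ≢ proj₂ e) E × AllPairs (λ e f → ¬ SameEnds e f) E

Adjacent : ∀ {m} → List (Edge m) → Fin m → Fin m → Set
Adjacent E a b = ((a , b) ∈ E) ⊎ ((b , a) ∈ E)

data WalkIn {m} (E : List (Edge m)) (P : Fin m → Set) : Fin m → Fin m → Set where
  here : ∀ {a} → P a → WalkIn E P a a
  step : ∀ {a b c} → P a → Adjacent E a b → WalkIn E P b c → WalkIn E P a c

Connected : ∀ {m} → List (Edge m) → Set
Connected {m} E = ∀ (a b : Fin m) → WalkIn E (λ _ → ⊤) a b

IsTree : (m : ℕ) → List (Edge m) → Set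
IsTree m TE = 1 ≤ m × Connected TE × suc (length TE) ≡ m

record TreeDecomposition (n : ℕ) (E : List (Edge n)) : Set where
  field
    m        : ℕ
    treeEdges : List (Edge m)
    isTree   : IsTree m treeEdges
    bag      : Fin m → Subset n
    vertexCovered : ∀ (v : Fin n) → ∃ λ i → v Sub.∈ bag i
    edgeCovered   : ∀ {u v} → (u , v) ∈ E → ∃ λ i → u Sub.∈ bag i × v Sub.∈ bag i
    subtreeConnected : ∀ (v : Fin n) (i j : Fin m) → v Sub.∈ bag i → v Sub.∈ bag j →
                       WalkIn treeEdges (λ k → v Sub.∈ bag k) i j

width≤ : ∀ {n E} → TreeDecomposition n E → ℕ → Set
width≤ D w = ∀ i → ∣ TreeDecomposition.bag D i ∣ ≤ suc w

TreewidthAtMost : (n : ℕ) → List (Edge n) → ℕ → Set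
TreewidthAtMost n E w = Σ (TreeDecomposition n E) λ D → width≤ D w

record State (n : ℕ) : Set where
  constructor mkState
  field
    alive : List (Fin n)
    edges : List (Edge n)

open State public

pairs : ∀ {A : Set} → List A → List (A × A)
pairs []       = []
pairs (x ∷ xs) = map (x ,_) xs ++ pairs xs

data ParallelStep {n} : State n → State n → Set where
  par : ∀ {V E e f rest} → E ↭ (e ∷ f ∷ rest) → SameEnds e f →
        ParallelStep (mkState V E) (mkState V (e ∷ rest))

data StarMeshStep {n} (s t : Fin n) : ℕ → State n → State n → Set where
  starMesh : ∀ {V V' E c inc rest} (nbrs : List (Fin n)) →
             V ↭ (c ∷ V') → c ≢ s → c ≢ t →
             E ↭ (inc ++ rest) →
             Pointwise (λ e v → SameEnds e (c , v)) inc nbrs →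
             All (λ e → proj₁ e ≢ c × proj₂ e ≢ c) rest →
             Unique nbrs →
             StarMeshStep s t (length nbrs) (mkState V E) (mkState V' (rest ++ pairs nbrs))

data Reduction {n} (s t : Fin n) (d : ℕ) : State n → State n → ℕ → ℕ → Set where
  done  : ∀ {S} → Reduction s t d S S 0 0
  parR  : ∀ {S S' T p q} → ParallelStep S S' → Reduction s t d S' T p q →
          Reduction s t d S T (suc p) q
  smR   : ∀ {S S' T p q k} → StarMeshStep s t k S S' → k ≤ d →
          Reduction s t d S' T p q → Reduction s t d S T p (suc q)

module Submission where

-- Add the terminal s to every bag, so that bags have at most w + 2 vertices. While a non-terminal
-- vertex is alive, take a leaf i of the decomposition tree with neighbour j. If every live vertex of
-- bag i lies in bag j, the leaf can be deleted. Otherwise a vertex of bag i ∖ bag j lies in no other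
-- bag, so all its neighbours lie in bag i and its degree is at most w + 1; it is not s, which lies in
-- every bag, and of two leaves at most one can have t as such a vertex. A star-mesh transformation
-- at it, followed by merging the at most w(w + 1) new parallel edges, keeps the graph simple and the
-- decomposition valid, since the new edges join vertices of bag i. Every vertex is eliminated at most
-- once, giving at most n star-mesh transformations and 2w²n parallel reductions, and at the end only
-- s and t remain, joined by at most one edge.

open import Defs
open import Algebra.Properties.CommutativeSemigroup using (interchange)
open import Data.Bool using (true; false)
open import Data.Empty using (⊥-elim)
open import Data.Fin using (Fin)
open import Data.Fin.Properties using (_≟_)
open import Data.Fin.Subset as Sub using (Subset; ⁅_⁆; _∪_; _─_)
import Data.Fin.Subset.Properties as Subₚ
open import Data.List using (List; []; _∷_; _++_; map; length; allFin)
open import Data.List.Properties using (++-identityʳ; length-++; length-map; length-tabulate)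
open import Data.List.Membership.Propositional using (_∈_; _∉_; find; lose)
open import Data.List.Membership.Propositional.Properties using (∈-++⁺ʳ; ∈-++⁻; ∈-map⁻; ∈-allFin)
open import Data.List.Relation.Unary.Any using (here; there; any?)
open import Data.List.Relation.Unary.All as All using (All; []; _∷_)
import Data.List.Relation.Unary.All.Properties as Allₚ
open import Data.List.Relation.Unary.AllPairs using (AllPairs; []; _∷_)
open import Data.List.Relation.Unary.Unique.Propositional using (Unique)
open import Data.List.Relation.Unary.Unique.Propositional.Properties using (allFin⁺; Unique[x∷xs]⇒x∉xs)
open import Data.List.Relation.Binary.Pointwise using (Pointwise; []; _∷_)
open import Data.List.Relation.Binary.Permutation.Propositional
  using (_↭_; ↭-refl; ↭-prep; ↭-swap; ↭-trans; ↭-sym; ↭-reflexive; ↭⇒↭ₛ)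
open import Data.List.Relation.Binary.Permutation.Propositional.Properties
  using (∈-resp-↭; All-resp-↭; ↭-length; shift; ++⁺ʳ)
import Data.List.Relation.Binary.Permutation.Setoid.Properties as Permutationₛ
open import Data.Nat using (ℕ; zero; suc; _+_; _*_; _^_; _≤_; _<_; z≤n; s≤s)
open import Data.Nat.Properties hiding (_≟_)
open import Data.Nat.Tactic.RingSolver using (solve-∀)
open import Data.Product using (∃; ∃₂; _×_; _,_; proj₁; proj₂)
open import Data.Sum as Sum using (_⊎_; inj₁; inj₂; [_,_]′)
open import Data.Unit using (⊤)
open import Data.Vec using ([]; _∷_)
open import Function using (_∘_)
open import Relation.Binary.PropositionalEquality as ≡
  using (_≡_; _≢_; refl; sym; cong; subst; ≢-sym)
open import Relation.Nullary using (¬_; Dec; yes; no)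
open import Relation.Nullary.Decidable using (_×-dec_; _⊎-dec_; ¬?; decidable-stable)

module _ {A : Set} where

  ∈-∃↭ : ∀ {x : A} {xs} → x ∈ xs → ∃ λ ys → xs ↭ x ∷ ys
  ∈-∃↭ {xs = _ ∷ xs} (here refl) = xs , ↭-refl
  ∈-∃↭ {xs = y ∷ _} (there x∈xs) =
    let ys , xs↭ = ∈-∃↭ x∈xs in y ∷ ys , ↭-trans (↭-prep y xs↭) (↭-swap y _ ↭-refl)

  ∈-↭∷⁻ : ∀ {x y : A} {xs ys} → xs ↭ x ∷ ys → y ∈ xs → y ≢ x → y ∈ ys
  ∈-↭∷⁻ xs↭ y∈xs y≢x with ∈-resp-↭ xs↭ y∈xs
  ... | here y≡x = ⊥-elim (y≢x y≡x)
  ... | there y∈ys = y∈ys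

  Unique-resp-↭ : ∀ {xs ys : List A} → xs ↭ ys → Unique xs → Unique ys
  Unique-resp-↭ xs↭ys = Permutationₛ.Unique-resp-↭ (≡.setoid A) (↭⇒↭ₛ xs↭ys)

  AllPairs-resp-↭ : ∀ {R : A → A → Set} → (∀ {x y} → R x y → R y x) →
                    ∀ {xs ys} → xs ↭ ys → AllPairs R xs → AllPairs R ys
  AllPairs-resp-↭ R-sym xs↭ys =
    Permutationₛ.AllPairs-resp-↭ (≡.setoid A) R-sym ((λ { refl r → r }) , (λ { refl r → r })) (↭⇒↭ₛ xs↭ys)

  AllPairs-++⁻ʳ : ∀ {R : A → A → Set} xs {ys} → AllPairs R (xs ++ ys) → AllPairs R ys
  AllPairs-++⁻ʳ []       rs       = rs
  AllPairs-++⁻ʳ (_ ∷ xs) (_ ∷ rs) = AllPairs-++⁻ʳ xs rs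

  ∉-↭∷ : ∀ {x : A} {xs ys} → Unique xs → xs ↭ x ∷ ys → x ∉ ys
  ∉-↭∷ u xs↭ = Unique[x∷xs]⇒x∉xs (Unique-resp-↭ xs↭ u)

  Unique-↭∷ : ∀ {x : A} {xs ys} → Unique xs → xs ↭ x ∷ ys → Unique ys
  Unique-↭∷ u xs↭ with _ ∷ u′ ← Unique-resp-↭ xs↭ u = u′

  length-pairs≤ : ∀ w (xs : List A) → length xs ≤ suc w → length (pairs xs) ≤ w * length xs
  length-pairs≤ w []       _         = z≤n
  length-pairs≤ w (x ∷ xs) (s≤s |xs|≤w) = begin
    length (map (x ,_) xs ++ pairs xs)   ≡⟨ length-++ (map (x ,_) xs) ⟩
    length (map (x ,_) xs) + length (pairs xs) ≡⟨ cong (_+ length (pairs xs)) (length-map (x ,_) xs) ⟩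
    length xs + length (pairs xs)        ≤⟨ +-mono-≤ |xs|≤w (length-pairs≤ w xs (m≤n⇒m≤1+n |xs|≤w)) ⟩
    w + w * length xs                    ≡⟨ sym (*-suc w (length xs)) ⟩
    w * suc (length xs)                  ∎
    where open ≤-Reasoning

module _ {n : ℕ} where

  SameEnds-sym : ∀ {e f : Edge n} → SameEnds e f → SameEnds f e
  SameEnds-sym (inj₁ (refl , refl)) = inj₁ (refl , refl)
  SameEnds-sym (inj₂ (refl , refl)) = inj₂ (refl , refl)

  SameEnds-trans : ∀ {e f g : Edge n} → SameEnds e f → SameEnds f g → SameEnds e g
  SameEnds-trans (inj₁ (refl , refl)) f~g                  = f~g
  SameEnds-trans (inj₂ (refl , refl)) (inj₁ (refl , refl)) = inj₂ (refl , refl)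
  SameEnds-trans (inj₂ (refl , refl)) (inj₂ (refl , refl)) = inj₁ (refl , refl)

  SameEnds? : ∀ (e f : Edge n) → Dec (SameEnds e f)
  SameEnds? (a , b) (c , d) = ((a ≟ c) ×-dec (b ≟ d)) ⊎-dec ((a ≟ d) ×-dec (b ≟ c))

  SimpleGraph-resp-↭ : ∀ {E E′ : List (Edge n)} → E ↭ E′ → SimpleGraph E → SimpleGraph E′
  SimpleGraph-resp-↭ E↭E′ (loopless , no-parallel) =
    All-resp-↭ E↭E′ loopless , AllPairs-resp-↭ (_∘ SameEnds-sym) E↭E′ no-parallel

  SimpleGraph-++⁻ʳ : ∀ (E : List (Edge n)) {E′} → SimpleGraph (E ++ E′) → SimpleGraph E′
  SimpleGraph-++⁻ʳ E (loopless , no-parallel) = Allₚ.++⁻ʳ E loopless , AllPairs-++⁻ʳ E no-parallel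

  Adjacent-sym : ∀ {E : List (Edge n)} {a b} → Adjacent E a b → Adjacent E b a
  Adjacent-sym = [ inj₂ , inj₁ ]′

  WalkIn-head : ∀ {E : List (Edge n)} {P a b} → WalkIn E P a b → P a
  WalkIn-head (here pa)     = pa
  WalkIn-head (step pa _ _) = pa

  WalkIn-map : ∀ {E : List (Edge n)} {P Q : Fin n → Set} → (∀ {k} → P k → Q k) →
               ∀ {a b} → WalkIn E P a b → WalkIn E Q a b
  WalkIn-map f (here pa)         = here (f pa)
  WalkIn-map f (step pa adj walk) = step (f pa) adj (WalkIn-map f walk)

  walk-trapped : ∀ {E : List (Edge n)} {P i c} → (∀ {b} → Adjacent E i b → b ≡ i) → WalkIn E P i c → c ≡ i
  walk-trapped trapped (here _)         = refl
  walk-trapped trapped (step _ adj walk) with refl ← trapped adj = walk-trapped trapped walk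

_++ᴿ_ : ∀ {n} {s t : Fin n} {d S T U p q p′ q′} →
        Reduction s t d S T p q → Reduction s t d T U p′ q′ → Reduction s t d S U (p + p′) (q + q′)
done            ++ᴿ r′ = r′
parR parallel r ++ᴿ r′ = parR parallel (r ++ᴿ r′)
smR mesh k≤d r  ++ᴿ r′ = smR mesh k≤d (r ++ᴿ r′)

∣p∪q∣≤∣p∣+∣q∣ : ∀ {n} (p q : Subset n) → Sub.∣ p ∪ q ∣ ≤ Sub.∣ p ∣ + Sub.∣ q ∣
∣p∪q∣≤∣p∣+∣q∣ []          []          = z≤n
∣p∪q∣≤∣p∣+∣q∣ (true ∷ p)  (true ∷ q)  = s≤s (≤-trans (∣p∪q∣≤∣p∣+∣q∣ p q) (+-monoʳ-≤ Sub.∣ p ∣ (n≤1+n Sub.∣ q ∣)))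
∣p∪q∣≤∣p∣+∣q∣ (true ∷ p)  (false ∷ q) = s≤s (∣p∪q∣≤∣p∣+∣q∣ p q)
∣p∪q∣≤∣p∣+∣q∣ (false ∷ p) (true ∷ q)  = ≤-trans (s≤s (∣p∪q∣≤∣p∣+∣q∣ p q)) (≤-reflexive (sym (+-suc _ _)))
∣p∪q∣≤∣p∣+∣q∣ (false ∷ p) (false ∷ q) = ∣p∪q∣≤∣p∣+∣q∣ p q

Unique⇒length≤∣∣ : ∀ {n} (S : Subset n) {xs : List (Fin n)} → Unique xs → All (Sub._∈ S) xs → length xs ≤ Sub.∣ S ∣
Unique⇒length≤∣∣ S {[]}     _            _            = z≤n
Unique⇒length≤∣∣ S {x ∷ xs} (x∉xs ∷ u) (x∈S ∷ xs⊆S) = begin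
  suc (length xs)          ≤⟨ s≤s (Unique⇒length≤∣∣ (S ─ ⁅ x ⁆) u (All.zipWith in-S─x (x∉xs , xs⊆S))) ⟩
  suc Sub.∣ S ─ ⁅ x ⁆ ∣    ≤⟨ Subₚ.p∩q≢∅⇒∣p─q∣<∣p∣ S ⁅ x ⁆ (x , Subₚ.x∈p∩q⁺ (x∈S , Subₚ.x∈⁅x⁆ x)) ⟩
  Sub.∣ S ∣                ∎
  where
  open ≤-Reasoning
  in-S─x : ∀ {y} → x ≢ y × y Sub.∈ S → y Sub.∈ (S ─ ⁅ x ⁆)
  in-S─x (x≢y , y∈S) = Subₚ.x∈p∧x∉q⇒x∈p─q y∈S (Subₚ.x≢y⇒x∉⁅y⁆ (≢-sym x≢y))

indicator : ∀ {P : Set} → Dec P → ℕ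
indicator (yes _) = 1
indicator (no _)  = 0

module _ {m : ℕ} where

  Incident : Fin m → Edge m → Set
  Incident a e = proj₁ e ≡ a ⊎ proj₂ e ≡ a

  incident? : ∀ a e → Dec (Incident a e)
  incident? a (x , y) = (x ≟ a) ⊎-dec (y ≟ a)

  degree : Fin m → List (Edge m) → ℕ
  degree a []      = 0
  degree a (e ∷ L) = indicator (incident? a e) + degree a L

  degreeSum : List (Edge m) → List (Fin m) → ℕ
  degreeSum L []      = 0
  degreeSum L (a ∷ A) = degree a L + degreeSum L A

  endpointCount : Edge m → List (Fin m) → ℕ
  endpointCount e []      = 0
  endpointCount e (a ∷ A) = indicator (incident? a e) + endpointCount e A

  occurrences : Fin m → List (Fin m) → ℕ
  occurrences x []      = 0
  occurrences x (a ∷ A) = indicator (x ≟ a) + occurrences x A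

  indicator-incident≤ : ∀ a e → indicator (incident? a e) ≤ indicator (proj₁ e ≟ a) + indicator (proj₂ e ≟ a)
  indicator-incident≤ a (x , y) with x ≟ a | y ≟ a
  ... | yes _ | yes _ = s≤s z≤n
  ... | yes _ | no _  = s≤s z≤n
  ... | no _  | yes _ = s≤s z≤n
  ... | no _  | no _  = z≤n

  occurrences-∉ : ∀ {x} A → x ∉ A → occurrences x A ≡ 0
  occurrences-∉         []      _   = refl
  occurrences-∉ {x} (a ∷ A) x∉ with x ≟ a
  ... | yes x≡a = ⊥-elim (x∉ (here x≡a))
  ... | no _    = occurrences-∉ A (x∉ ∘ there)

  occurrences≤1 : ∀ x {A} → Unique A → occurrences x A ≤ 1
  occurrences≤1 x {[]}    _          = z≤n
  occurrences≤1 x {a ∷ A} (a∉A ∷ u) with x ≟ a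
  ... | yes refl = ≤-reflexive (cong suc (occurrences-∉ A (Allₚ.All¬⇒¬Any a∉A)))
  ... | no _     = occurrences≤1 x u

  endpointCount≤ : ∀ e A → endpointCount e A ≤ occurrences (proj₁ e) A + occurrences (proj₂ e) A
  endpointCount≤ e []      = z≤n
  endpointCount≤ e (a ∷ A) = ≤-trans (+-mono-≤ (indicator-incident≤ a e) (endpointCount≤ e A))
    (≤-reflexive (interchange +-commutativeSemigroup (indicator (proj₁ e ≟ a)) (indicator (proj₂ e ≟ a))
                                                    (occurrences (proj₁ e) A) (occurrences (proj₂ e) A)))

  degreeSum-∷ : ∀ e L A → degreeSum (e ∷ L) A ≡ endpointCount e A + degreeSum L A
  degreeSum-∷ e L []      = refl
  degreeSum-∷ e L (a ∷ A) = ≡.trans (cong (degree a (e ∷ L) +_) (degreeSum-∷ e L A))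
    (interchange +-commutativeSemigroup (indicator (incident? a e)) (degree a L) (endpointCount e A) (degreeSum L A))

  degreeSum-[] : ∀ A → degreeSum [] A ≡ 0
  degreeSum-[] []      = refl
  degreeSum-[] (_ ∷ A) = degreeSum-[] A

  handshake : ∀ L {A} → Unique A → degreeSum L A ≤ 2 * length L
  handshake [] {A} _ = ≤-reflexive (degreeSum-[] A)
  handshake (e ∷ L) {A} u = begin
    degreeSum (e ∷ L) A                ≡⟨ degreeSum-∷ e L A ⟩
    endpointCount e A + degreeSum L A  ≤⟨ +-mono-≤ endpoints≤2 (handshake L u) ⟩
    2 + 2 * length L                   ≡⟨ sym (*-suc 2 (length L)) ⟩
    2 * length (e ∷ L)                 ∎
    where
    open ≤-Reasoning
    endpoints≤2 : endpointCount e A ≤ 2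
    endpoints≤2 = ≤-trans (endpointCount≤ e A) (+-mono-≤ (occurrences≤1 _ u) (occurrences≤1 _ u))

  -- Either two nodes of degree ≤ 1, or a lower bound on the degree sum that rules out a second one.
  data LowDegreeNodes (L : List (Edge m)) (A : List (Fin m)) : Set where
    two  : ∀ {a b} → a ∈ A → b ∈ A → a ≢ b → degree a L ≤ 1 → degree b L ≤ 1 → LowDegreeNodes L A
    one  : ∀ {a} → a ∈ A → degree a L ≤ 1 → 2 * length A ≤ suc (degreeSum L A) → LowDegreeNodes L A
    none : 2 * length A ≤ degreeSum L A → LowDegreeNodes L A

  lowDegreeNodes : ∀ L {A} → Unique A → All (λ a → 1 ≤ degree a L) A → LowDegreeNodes L A
  lowDegreeNodes L {[]}    _          _             = none z≤n
  lowDegreeNodes L {a ∷ A} (a∉A ∷ u) (1≤da ∷ 1≤ds) with lowDegreeNodes L u 1≤ds | degree a L ≤? 1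
  ... | two b∈ c∈ b≢c db dc | _      = two (there b∈) (there c∈) b≢c db dc
  ... | one b∈ db bound     | yes da = two (here refl) (there b∈) (All.lookup a∉A b∈) da db
  ... | one b∈ db bound     | no da  = one (there b∈) db (begin
          2 * suc (length A)             ≡⟨ *-suc 2 (length A) ⟩
          2 + 2 * length A               ≤⟨ +-mono-≤ (≰⇒> da) bound ⟩
          degree a L + suc (degreeSum L A) ≡⟨ +-suc (degree a L) (degreeSum L A) ⟩
          suc (degreeSum L (a ∷ A))      ∎)
    where open ≤-Reasoning
  ... | none bound          | yes da = one (here refl) da (begin
          2 * suc (length A)              ≡⟨ *-suc 2 (length A) ⟩
          suc (1 + 2 * length A)          ≤⟨ s≤s (+-mono-≤ 1≤da bound) ⟩
          suc (degreeSum L (a ∷ A))       ∎)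
    where open ≤-Reasoning
  ... | none bound          | no da  = none (begin
          2 * suc (length A)              ≡⟨ *-suc 2 (length A) ⟩
          2 + 2 * length A                ≤⟨ +-mono-≤ (≰⇒> da) bound ⟩
          degreeSum L (a ∷ A)             ∎)
    where open ≤-Reasoning

  -- The degrees of a tree sum to 2(|A| - 1), so at most |A| - 2 nodes can have degree ≥ 2.
  two-low-degree-nodes : ∀ L {A} → Unique A → All (λ a → 1 ≤ degree a L) A → suc (length L) ≡ length A →
                         ∃₂ λ a b → a ∈ A × b ∈ A × a ≢ b × degree a L ≤ 1 × degree b L ≤ 1
  two-low-degree-nodes L {A} u 1≤ds size = from (lowDegreeNodes L u 1≤ds)
    where
    2|A| : 2 * length A ≡ 2 + 2 * length L
    2|A| = ≡.trans (cong (2 *_) (sym size)) (*-suc 2 (length L))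
    from : LowDegreeNodes L A → ∃₂ λ a b → a ∈ A × b ∈ A × a ≢ b × degree a L ≤ 1 × degree b L ≤ 1
    from (two a∈ b∈ a≢b da db) = _ , _ , a∈ , b∈ , a≢b , da , db
    from (one _ _ bound)       = ⊥-elim (n≮n (suc (2 * length L))
                                   (≤-trans (≤-reflexive (sym 2|A|)) (≤-trans bound (s≤s (handshake L u)))))
    from (none bound)          = ⊥-elim (n≮n (2 * length L)
                                   (≤-trans (n≤1+n _) (≤-trans (≤-reflexive (sym 2|A|)) (≤-trans bound (handshake L u)))))

  1≤degree : ∀ {a e} L → e ∈ L → Incident a e → 1 ≤ degree a L
  1≤degree {a} {e} (e ∷ L) (here refl) a∈e with incident? a e
  ... | yes _  = s≤s z≤n
  ... | no a∉e = ⊥-elim (a∉e a∈e)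
  1≤degree (f ∷ L) (there e∈L) a∈e = ≤-trans (1≤degree L e∈L a∈e) (m≤n+m _ _)

  degree≡0 : ∀ a L → degree a L ≡ 0 → All (¬_ ∘ Incident a) L
  degree≡0 a []      _ = []
  degree≡0 a (e ∷ L) d≡0 with incident? a e
  ... | no a∉e = a∉e ∷ degree≡0 a L d≡0

  degree≡1 : ∀ a L → degree a L ≡ 1 → ∃₂ λ e L′ → L ↭ e ∷ L′ × Incident a e × All (¬_ ∘ Incident a) L′
  degree≡1 a (e ∷ L) d≡1 with incident? a e
  ... | yes a∈e = e , L , ↭-refl , a∈e , degree≡0 a L (suc-injective d≡1)
  ... | no a∉e with e′ , L′ , L↭ , a∈e′ , rest ← degree≡1 a L d≡1 =
    e′ , e ∷ L′ , ↭-trans (↭-prep e L↭) (↭-swap e e′ ↭-refl) , a∈e′ , a∉e ∷ rest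

  record Leaf (TE : List (Edge m)) (i : Fin m) : Set where
    field
      neighbour      : Fin m
      edge           : Edge m
      others         : List (Edge m)
      split          : TE ↭ edge ∷ others
      shape          : edge ≡ (i , neighbour) ⊎ edge ≡ (neighbour , i)
      others-avoid   : All (¬_ ∘ Incident i) others
      neighbour≢i    : neighbour ≢ i
      only-neighbour : ∀ {b} → Adjacent TE i b → b ≡ neighbour

    edge-incident : Incident i edge
    edge-incident = [ inj₁ ∘ cong proj₁ , inj₂ ∘ cong proj₂ ]′ shape

    ∈-others : ∀ {f} → f ∈ TE → ¬ Incident i f → f ∈ others
    ∈-others f∈TE i∉f with ∈-resp-↭ split f∈TE
    ... | here refl = ⊥-elim (i∉f edge-incident)
    ... | there f∈  = f∈

    edge∈TE : edge ∈ TE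
    edge∈TE = ∈-resp-↭ (↭-sym split) (here refl)

    others⊆TE : ∀ {f} → f ∈ others → f ∈ TE
    others⊆TE = ∈-resp-↭ (↭-sym split) ∘ there

    bypass : ∀ {P a b} → a ≢ i → b ≢ i → WalkIn TE P a b → WalkIn others P a b
    bypass a≢i b≢i (here pa) = here pa
    bypass {a = a} a≢i b≢i (step {b = x} pa adj walk) with x ≟ i | walk
    ... | no x≢i   | _ = step pa (Sum.map (λ e∈ → ∈-others e∈ [ a≢i , x≢i ]′)
                                         (λ e∈ → ∈-others e∈ [ x≢i , a≢i ]′) adj)
                              (bypass x≢i b≢i walk)
    ... | yes refl | here _ = ⊥-elim (b≢i refl)
    ... | yes refl | step _ adj′ walk′
      with refl ← only-neighbour (Adjacent-sym adj) | refl ← only-neighbour adj′ = bypass a≢i b≢i walk′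

  sole-incident-edge : ∀ {TE e others a} → TE ↭ e ∷ others → All (¬_ ∘ Incident a) others →
                       ∀ {f} → f ∈ TE → Incident a f → f ≡ e
  sole-incident-edge split avoid f∈ a∈f with ∈-resp-↭ split f∈
  ... | here f≡e  = f≡e
  ... | there f∈′ = ⊥-elim (All.lookup avoid f∈′ a∈f)

  leaf : ∀ {TE i P a} → degree i TE ≡ 1 → a ≢ i → WalkIn TE P i a → Leaf TE i
  leaf {TE} {i} d≡1 a≢i walk with degree≡1 i TE d≡1
  ... | (x , y) , others , split , inj₁ refl , avoid = record
    { neighbour = y ; edge = (x , y) ; others = others ; split = split ; shape = inj₁ refl
    ; others-avoid = avoid ; neighbour≢i = λ { refl → a≢i (walk-trapped only-y walk) } ; only-neighbour = only-y }
    where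
    only-y : ∀ {b} → Adjacent TE x b → b ≡ y
    only-y (inj₁ e∈) with refl ← sole-incident-edge split avoid e∈ (inj₁ refl) = refl
    only-y (inj₂ e∈) with refl ← sole-incident-edge split avoid e∈ (inj₂ refl) = refl
  ... | (x , y) , others , split , inj₂ refl , avoid = record
    { neighbour = x ; edge = (x , y) ; others = others ; split = split ; shape = inj₂ refl
    ; others-avoid = avoid ; neighbour≢i = λ { refl → a≢i (walk-trapped only-x walk) } ; only-neighbour = only-x }
    where
    only-x : ∀ {b} → Adjacent TE y b → b ≡ x
    only-x (inj₁ e∈) with refl ← sole-incident-edge split avoid e∈ (inj₁ refl) = refl
    only-x (inj₂ e∈) with refl ← sole-incident-edge split avoid e∈ (inj₂ refl) = refl

module _ {n : ℕ} where

  Loopless : Edge n → Set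
  Loopless e = proj₁ e ≢ proj₂ e

  ∈-pairs⁻ : ∀ (xs : List (Fin n)) {e} → e ∈ pairs xs → proj₁ e ∈ xs × proj₂ e ∈ xs
  ∈-pairs⁻ (x ∷ xs) e∈ with ∈-++⁻ (map (x ,_) xs) e∈
  ... | inj₁ e∈map with _ , y∈ , refl ← ∈-map⁻ (x ,_) e∈map = here refl , there y∈
  ... | inj₂ e∈pairs = let x∈ , y∈ = ∈-pairs⁻ xs e∈pairs in there x∈ , there y∈

  pairs-loopless : ∀ {xs : List (Fin n)} → Unique xs → All Loopless (pairs xs)
  pairs-loopless {[]}     []          = []
  pairs-loopless {x ∷ xs} (x∉xs ∷ u) = Allₚ.++⁺ (Allₚ.map⁺ x∉xs) (pairs-loopless u)

  Adjacent-∷ : ∀ {e} {E : List (Edge n)} {a b} → Adjacent E a b → Adjacent (e ∷ E) a b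
  Adjacent-∷ = Sum.map there there

  ¬Adjacent : ∀ {x y} {E : List (Edge n)} → All (¬_ ∘ SameEnds (x , y)) E → ¬ Adjacent E x y
  ¬Adjacent distinct (inj₁ xy∈E) = All.lookup distinct xy∈E (inj₁ (refl , refl))
  ¬Adjacent distinct (inj₂ yx∈E) = All.lookup distinct yx∈E (inj₂ (refl , refl))

  Adjacent⇒≢ : ∀ {E : List (Edge n)} {a b} → All Loopless E → Adjacent E a b → a ≢ b
  Adjacent⇒≢ loopless (inj₁ ab∈E) = All.lookup loopless ab∈E
  Adjacent⇒≢ loopless (inj₂ ba∈E) = ≢-sym (All.lookup loopless ba∈E)

  at-most-one-edge : ∀ {a b} {E : List (Edge n)} → AllPairs (λ e f → ¬ SameEnds e f) E →
                     All (λ e → SameEnds e (a , b)) E → length E ≤ 1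
  at-most-one-edge []                    _                  = z≤n
  at-most-one-edge (_ ∷ [])              _                  = s≤s z≤n
  at-most-one-edge ((e≁f ∷ _) ∷ _) (e~ab ∷ f~ab ∷ _) = ⊥-elim (e≁f (SameEnds-trans e~ab (SameEnds-sym f~ab)))

  record Star (c : Fin n) (E : List (Edge n)) : Set where
    field
      spokes      : List (Edge n)
      neighbours  : List (Fin n)
      rest        : List (Edge n)
      split       : E ↭ spokes ++ rest
      spokes-to   : Pointwise (λ e v → SameEnds e (c , v)) spokes neighbours
      rest-avoids : All (λ e → proj₁ e ≢ c × proj₂ e ≢ c) rest
      adjacent    : All (Adjacent E c) neighbours
      unique      : Unique neighbours

  star : ∀ c (E : List (Edge n)) → AllPairs (λ e f → ¬ SameEnds e f) E → Star c E
  star c []            _ = record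
    { spokes = [] ; neighbours = [] ; rest = [] ; split = ↭-refl ; spokes-to = []
    ; rest-avoids = [] ; adjacent = [] ; unique = [] }
  star c ((x , y) ∷ E) (distinct ∷ no-parallel) with x ≟ c | y ≟ c | star c E no-parallel
  ... | yes refl | _ | S = record
    { spokes = (x , y) ∷ spokes ; neighbours = y ∷ neighbours ; rest = rest ; split = ↭-prep _ split
    ; spokes-to = inj₁ (refl , refl) ∷ spokes-to ; rest-avoids = rest-avoids
    ; adjacent = inj₁ (here refl) ∷ All.map Adjacent-∷ adjacent
    ; unique = All.map (λ { adj refl → ¬Adjacent distinct adj }) adjacent ∷ unique }
    where open Star S
  ... | no _ | yes refl | S = record
    { spokes = (x , y) ∷ spokes ; neighbours = x ∷ neighbours ; rest = rest ; split = ↭-prep _ split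
    ; spokes-to = inj₂ (refl , refl) ∷ spokes-to ; rest-avoids = rest-avoids
    ; adjacent = inj₂ (here refl) ∷ All.map Adjacent-∷ adjacent
    ; unique = All.map (λ { adj refl → ¬Adjacent distinct (Adjacent-sym adj) }) adjacent ∷ unique }
    where open Star S
  ... | no x≢c | no y≢c | S = record
    { spokes = spokes ; neighbours = neighbours ; rest = (x , y) ∷ rest
    ; split = ↭-trans (↭-prep _ split) (↭-sym (shift (x , y) spokes rest))
    ; spokes-to = spokes-to ; rest-avoids = (x≢c , y≢c) ∷ rest-avoids
    ; adjacent = All.map Adjacent-∷ adjacent ; unique = unique }
    where open Star S

  record Simplification (s t : Fin n) (d : ℕ) (V : List (Fin n)) (E : List (Edge n)) (bound : ℕ) : Set where
    field
      edges′    : List (Edge n)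
      steps     : ℕ
      reduction : Reduction s t d (mkState V E) (mkState V edges′) steps 0
      simple    : SimpleGraph edges′
      steps≤    : steps ≤ bound
      ⊆-edges   : ∀ {e} → e ∈ edges′ → e ∈ E

  -- Each new edge is merged into a parallel edge of the simple part S, or else added to S.
  simplify : ∀ {s t d V E} S N → E ↭ S ++ N → SimpleGraph S → All Loopless N → Simplification s t d V E (length N)
  simplify {E = E} S [] E↭S simple-S _ = record
    { edges′ = E ; steps = 0 ; reduction = done ; steps≤ = z≤n ; ⊆-edges = λ e∈ → e∈
    ; simple = SimpleGraph-resp-↭ (↭-sym (↭-trans E↭S (↭-reflexive (++-identityʳ S)))) simple-S }
  simplify {E = E} S (x ∷ N) E↭ simple-S (x-loopless ∷ N-loopless) with any? (λ y → SameEnds? y x) S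
  ... | yes parallel with y , y∈S , y∥x ← find parallel with S′ , S↭ ← ∈-∃↭ y∈S = record
    { edges′ = edges′ ; steps = suc steps ; reduction = parR (par E↭yx y∥x) reduction
    ; simple = simple ; steps≤ = s≤s steps≤ ; ⊆-edges = ∈-resp-↭ (↭-sym E↭yx) ∘ skip-x ∘ ⊆-edges }
    where
    E↭yx : E ↭ y ∷ x ∷ S′ ++ N
    E↭yx = ↭-trans E↭ (↭-trans (shift x S N) (↭-trans (↭-prep x (++⁺ʳ N S↭)) (↭-swap x _ ↭-refl)))
    skip-x : ∀ {e y rest} → e ∈ y ∷ rest → e ∈ y ∷ x ∷ rest
    skip-x (here e≡y)  = here e≡y
    skip-x (there e∈) = there (there e∈)
    open Simplification (simplify (y ∷ S′) N ↭-refl (SimpleGraph-resp-↭ S↭ simple-S) N-loopless)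
  ... | no ¬parallel = record
    { edges′ = edges′ ; steps = steps ; reduction = reduction ; simple = simple
    ; steps≤ = m≤n⇒m≤1+n steps≤ ; ⊆-edges = ⊆-edges }
    where
    x-new : All (¬_ ∘ SameEnds x) S
    x-new = All.map (_∘ SameEnds-sym) (Allₚ.¬Any⇒All¬ S ¬parallel)
    open Simplification (simplify (x ∷ S) N (↭-trans E↭ (shift x S N))
                                  (x-loopless ∷ proj₁ simple-S , x-new ∷ proj₂ simple-S) N-loopless)

w*[1+w]≤2*w² : ∀ w → w * suc w ≤ 2 * w ^ 2
w*[1+w]≤2*w² zero    = z≤n
w*[1+w]≤2*w² (suc k) = begin
  suc k * suc (suc k)       ≤⟨ *-monoʳ-≤ (suc k) (s≤s (m≤n+m (suc k) k)) ⟩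
  suc k * (suc k + suc k)   ≡⟨ double (suc k) ⟩
  2 * suc k ^ 2             ∎
  where
  open ≤-Reasoning
  double : ∀ w → w * (w + w) ≡ 2 * (w * (w * 1))
  double = solve-∀

Reducible : ∀ {n} → Fin n → Fin n → ℕ → List (Fin n) → List (Edge n) → Set
Reducible s t w V E = ∃ λ F → ∃₂ λ p q → Reduction s t (suc w) (mkState V E) F p q ×
  alive F ↭ s ∷ t ∷ [] × length (edges F) ≤ 1 × p ≤ 2 * (w ^ 2 * length V) × q ≤ length V

module Elimination {n : ℕ} (s t : Fin n) (s≢t : s ≢ t) (w : ℕ) {m : ℕ} (bag : Fin m → Subset n)
                   (bag-size : ∀ k → Sub.∣ bag k ∣ ≤ 2 + w) (s∈bag : ∀ k → s Sub.∈ bag k) where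

  record Invariant (V : List (Fin n)) (E : List (Edge n)) : Set where
    field
      unique : Unique V
      s∈V    : s ∈ V
      t∈V    : t ∈ V
      ends∈V : ∀ {e} → e ∈ E → proj₁ e ∈ V × proj₂ e ∈ V
      simple : SimpleGraph E

  -- A tree decomposition of the current graph on the remaining tree nodes A, with the bags of the
  -- original decomposition (which are not shrunk when vertices disappear).
  record Decomposition (V : List (Fin n)) (E : List (Edge n)) (A : List (Fin m)) (TE : List (Edge m)) : Set where
    field
      nodes-unique      : Unique A
      tree-ends         : ∀ {e} → e ∈ TE → proj₁ e ∈ A × proj₂ e ∈ A
      tree-size         : suc (length TE) ≡ length A
      tree-connected    : ∀ {a b} → a ∈ A → b ∈ A → WalkIn TE (λ _ → ⊤) a b
      vertex-covered    : ∀ {v} → v ∈ V → ∃ λ k → k ∈ A × v Sub.∈ bag k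
      edge-covered      : ∀ {u v} → (u , v) ∈ E → ∃ λ k → k ∈ A × u Sub.∈ bag k × v Sub.∈ bag k
      subtree-connected : ∀ {v i j} → v ∈ V → i ∈ A → j ∈ A → v Sub.∈ bag i → v Sub.∈ bag j →
                          WalkIn TE (λ k → v Sub.∈ bag k) i j

  record Eliminable (V : List (Fin n)) (E : List (Edge n)) (A : List (Fin m)) : Set where
    field
      node           : Fin m
      node∈A         : node ∈ A
      vertex         : Fin n
      vertex∈V       : vertex ∈ V
      vertex≢s       : vertex ≢ s
      vertex≢t       : vertex ≢ t
      vertex∈bag     : vertex Sub.∈ bag node
      neighbours∈bag : ∀ {u} → Adjacent E vertex u → u Sub.∈ bag node

  record Shrinking (V : List (Fin n)) (E : List (Edge n)) (A : List (Fin m)) : Set where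
    field
      nodes′         : List (Fin m)
      tree′          : List (Edge m)
      decomposition′ : Decomposition V E nodes′ tree′
      fewer-nodes    : length nodes′ < length A

  module _ {V E A TE} (I : Invariant V E) (D : Decomposition V E A TE) where
    open Invariant I
    open Decomposition D

    Private : Fin m → Fin n → Set
    Private i v = v ∈ V × v ≢ s × v Sub.∈ bag i × (∀ {k} → k ∈ A → v Sub.∈ bag k → k ≡ i)

    private-eliminable : ∀ {i v} → i ∈ A → Private i v → v ≢ t → Eliminable V E A
    private-eliminable {i} {v} i∈A (v∈V , v≢s , v∈i , only-i) v≢t = record
      { node = i ; node∈A = i∈A ; vertex = v ; vertex∈V = v∈V ; vertex≢s = v≢s ; vertex≢t = v≢t
      ; vertex∈bag = v∈i ; neighbours∈bag = neighbours∈i }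
      where
      neighbours∈i : ∀ {u} → Adjacent E v u → u Sub.∈ bag i
      neighbours∈i (inj₁ vu∈E) with _ , k∈A , v∈k , u∈k ← edge-covered vu∈E with refl ← only-i k∈A v∈k = u∈k
      neighbours∈i (inj₂ uv∈E) with _ , k∈A , u∈k , v∈k ← edge-covered uv∈E with refl ← only-i k∈A v∈k = u∈k

    module _ {i} (i∈A : i ∈ A) (leaf-i : Leaf TE i) where
      open Leaf leaf-i

      neighbour∈A : neighbour ∈ A
      neighbour∈A = [ (λ eq → subst (_∈ A) (cong proj₂ eq) (proj₂ (tree-ends edge∈TE)))
                    , (λ eq → subst (_∈ A) (cong proj₁ eq) (proj₁ (tree-ends edge∈TE))) ]′ shape

      confined : ∀ {v k} → ¬ v Sub.∈ bag neighbour → WalkIn TE (λ k → v Sub.∈ bag k) i k → k ≡ i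
      confined v∉nb (here _)          = refl
      confined v∉nb (step _ adj walk) with refl ← only-neighbour adj = ⊥-elim (v∉nb (WalkIn-head walk))

      remove-leaf : (∀ {v} → v ∈ V → v Sub.∈ bag i → v Sub.∈ bag neighbour) → Shrinking V E A
      remove-leaf bag-i⊆neighbour = record
        { nodes′ = A′ ; tree′ = others ; fewer-nodes = ≤-reflexive (sym (↭-length A↭))
        ; decomposition′ = record
          { nodes-unique      = Unique-↭∷ nodes-unique A↭
          ; tree-ends         = λ e∈ → let a∈ , b∈ = tree-ends (others⊆TE e∈) ; i∉e = All.lookup others-avoid e∈
                                       in ∈-↭∷⁻ A↭ a∈ (i∉e ∘ inj₁) , ∈-↭∷⁻ A↭ b∈ (i∉e ∘ inj₂)
          ; tree-size         = suc-injective (≡.trans (cong suc (sym (↭-length split)))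
                                                       (≡.trans tree-size (↭-length A↭)))
          ; tree-connected    = λ a∈ b∈ → bypass (≢i a∈) (≢i b∈) (tree-connected (⊆A a∈) (⊆A b∈))
          ; vertex-covered    = vertex-covered′
          ; edge-covered      = edge-covered′
          ; subtree-connected = λ v∈ a∈ b∈ v∈a v∈b →
                                  bypass (≢i a∈) (≢i b∈) (subtree-connected v∈ (⊆A a∈) (⊆A b∈) v∈a v∈b) } }
        where
        A′ = proj₁ (∈-∃↭ i∈A)
        A↭ = proj₂ (∈-∃↭ i∈A)
        ⊆A : ∀ {a} → a ∈ A′ → a ∈ A
        ⊆A = ∈-resp-↭ (↭-sym A↭) ∘ there
        ≢i : ∀ {a} → a ∈ A′ → a ≢ i
        ≢i a∈ refl = ∉-↭∷ nodes-unique A↭ a∈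
        replace-i : ∀ {k} → k ∈ A → ∀ {us} → All (λ u → u ∈ V × u Sub.∈ bag k) us →
                    ∃ λ k′ → k′ ∈ A′ × All (λ u → u Sub.∈ bag k′) us
        replace-i {k} k∈A us∈ with k ≟ i
        ... | yes refl = neighbour , ∈-↭∷⁻ A↭ neighbour∈A neighbour≢i
                       , All.map (λ (u∈V , u∈i) → bag-i⊆neighbour u∈V u∈i) us∈
        ... | no k≢i   = k , ∈-↭∷⁻ A↭ k∈A k≢i , All.map proj₂ us∈
        vertex-covered′ : ∀ {v} → v ∈ V → ∃ λ k → k ∈ A′ × v Sub.∈ bag k
        vertex-covered′ v∈V with k , k∈A , v∈k ← vertex-covered v∈V
                              with k′ , k′∈ , v∈k′ ∷ [] ← replace-i k∈A ((v∈V , v∈k) ∷ []) = k′ , k′∈ , v∈k′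
        edge-covered′ : ∀ {u v} → (u , v) ∈ E → ∃ λ k → k ∈ A′ × u Sub.∈ bag k × v Sub.∈ bag k
        edge-covered′ uv∈E with k , k∈A , u∈k , v∈k ← edge-covered uv∈E | u∈V , v∈V ← ends∈V uv∈E
          with k′ , k′∈ , u∈k′ ∷ v∈k′ ∷ [] ← replace-i k∈A ((u∈V , u∈k) ∷ (v∈V , v∈k) ∷ []) =
          k′ , k′∈ , u∈k′ , v∈k′

      private-or-shrinking : (∃ (Private i)) ⊎ Shrinking V E A
      private-or-shrinking with any? (λ v → (v Subₚ.∈? bag i) ×-dec ¬? (v Subₚ.∈? bag neighbour)) V
      ... | yes some with v , v∈V , v∈i , v∉nb ← find some =
        inj₁ (v , v∈V , (λ { refl → v∉nb (s∈bag neighbour) }) , v∈i ,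
              λ k∈A v∈k → confined v∉nb (subtree-connected v∈V i∈A k∈A v∈i v∈k))
      ... | no ¬some = inj₂ (remove-leaf bag-i⊆neighbour)
        where
        bag-i⊆neighbour : ∀ {v} → v ∈ V → v Sub.∈ bag i → v Sub.∈ bag neighbour
        bag-i⊆neighbour {v} v∈V v∈i with v Subₚ.∈? bag neighbour
        ... | yes v∈nb = v∈nb
        ... | no v∉nb  = ⊥-elim (¬some (lose v∈V (v∈i , v∉nb)))

  another-node : ∀ {a b} {A : List (Fin m)} → Unique (a ∷ b ∷ A) → ∀ {x} → x ∈ a ∷ b ∷ A →
                 ∃ λ y → y ∈ a ∷ b ∷ A × y ≢ x
  another-node {a} {b} ((a≢b ∷ _) ∷ _) {x} _ with x ≟ a
  ... | yes refl = b , there (here refl) , ≢-sym a≢b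
  ... | no x≢a   = a , here refl , ≢-sym x≢a

  module _ {V E a b A′ TE} (D : Decomposition V E (a ∷ b ∷ A′) TE) where
    open Decomposition D
    private another = another-node nodes-unique

    1≤degree-node : ∀ {x} → x ∈ a ∷ b ∷ A′ → 1 ≤ degree x TE
    1≤degree-node x∈A with y , y∈A , y≢x ← another x∈A with tree-connected x∈A y∈A
    ... | here _             = ⊥-elim (y≢x refl)
    ... | step _ (inj₁ e∈) _ = 1≤degree TE e∈ (inj₁ refl)
    ... | step _ (inj₂ e∈) _ = 1≤degree TE e∈ (inj₂ refl)

    leaf-at : ∀ {x} → x ∈ a ∷ b ∷ A′ → degree x TE ≤ 1 → Leaf TE x
    leaf-at x∈A d≤1 with y , y∈A , y≢x ← another x∈A =
      leaf (≤-antisym d≤1 (1≤degree-node x∈A)) y≢x (tree-connected x∈A y∈A)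

  eliminable-or-shrinking : ∀ {V E TE} A → Invariant V E → Decomposition V E A TE →
                            ∀ {c} → c ∈ V → c ≢ s → c ≢ t → Eliminable V E A ⊎ Shrinking V E A
  eliminable-or-shrinking [] I D _ _ _ with () ← Decomposition.tree-size D
  eliminable-or-shrinking (a ∷ []) I D c∈V c≢s c≢t
    with _ , here refl , c∈a ← Decomposition.vertex-covered D c∈V =
    inj₁ (private-eliminable I D (here refl) (c∈V , c≢s , c∈a , λ { (here refl) _ → refl }) c≢t)
  eliminable-or-shrinking {TE = TE} (_ ∷ _ ∷ _) I D _ _ _
    with i₁ , i₂ , i₁∈A , i₂∈A , i₁≢i₂ , d₁ , d₂ ←
         two-low-degree-nodes TE (Decomposition.nodes-unique D) (All.tabulate (1≤degree-node D))
                              (Decomposition.tree-size D)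
    with private-or-shrinking I D i₁∈A (leaf-at D i₁∈A d₁)
  ... | inj₂ shrinking = inj₂ shrinking
  ... | inj₁ (v , private-v@(_ , _ , _ , only-i₁)) with v ≟ t
  ...   | no v≢t   = inj₁ (private-eliminable I D i₁∈A private-v v≢t)
  ...   | yes refl with private-or-shrinking I D i₂∈A (leaf-at D i₂∈A d₂)
  ...     | inj₂ shrinking = inj₂ shrinking
  ...     | inj₁ (_ , private-v′@(_ , _ , v′∈i₂ , _)) =
    inj₁ (private-eliminable I D i₂∈A private-v′ λ { refl → i₁≢i₂ (sym (only-i₁ i₂∈A v′∈i₂)) })

  record Eliminated (V : List (Fin n)) (E : List (Edge n)) (A : List (Fin m)) (TE : List (Edge m)) : Set where
    field
      V′            : List (Fin n)
      E′            : List (Edge n)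
      steps         : ℕ
      reduction     : Reduction s t (suc w) (mkState V E) (mkState V′ E′) steps 1
      invariant     : Invariant V′ E′
      decomposition : Decomposition V′ E′ A TE
      one-fewer     : suc (length V′) ≡ length V
      steps≤        : steps ≤ w * suc w

  eliminate : ∀ {V E A TE} → Invariant V E → Decomposition V E A TE → Eliminable V E A → Eliminated V E A TE
  eliminate {V} {E} {A} {TE} I D el = record
    { V′ = V′ ; E′ = R.edges′ ; steps = R.steps
    ; reduction = smR (starMesh neighbours V↭ vertex≢s vertex≢t split spokes-to rest-avoids unique) degree≤ R.reduction
    ; invariant = record
      { unique = Unique-↭∷ I.unique V↭
      ; s∈V = ∈-↭∷⁻ V↭ I.s∈V (≢-sym vertex≢s) ; t∈V = ∈-↭∷⁻ V↭ I.t∈V (≢-sym vertex≢t)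
      ; ends∈V = ends∈V′ ; simple = R.simple }
    ; decomposition = record
      { nodes-unique = D.nodes-unique ; tree-ends = D.tree-ends ; tree-size = D.tree-size
      ; tree-connected = D.tree-connected ; vertex-covered = D.vertex-covered ∘ V′⊆V
      ; edge-covered = edge-covered′ ; subtree-connected = D.subtree-connected ∘ V′⊆V }
    ; one-fewer = sym (↭-length V↭)
    ; steps≤ = begin
        R.steps                     ≤⟨ R.steps≤ ⟩
        length (pairs neighbours)   ≤⟨ length-pairs≤ w neighbours degree≤ ⟩
        w * length neighbours       ≤⟨ *-monoʳ-≤ w degree≤ ⟩
        w * suc w                   ∎ }
    where
    module I = Invariant I
    module D = Decomposition D
    open Eliminable el
    open Star (star vertex E (proj₂ I.simple))
    open ≤-Reasoning
    V′ = proj₁ (∈-∃↭ vertex∈V)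
    V↭ = proj₂ (∈-∃↭ vertex∈V)
    V′⊆V : ∀ {v} → v ∈ V′ → v ∈ V
    V′⊆V = ∈-resp-↭ (↭-sym V↭) ∘ there
    vertex≢neighbours : All (vertex ≢_) neighbours
    vertex≢neighbours = All.map (Adjacent⇒≢ (proj₁ I.simple)) adjacent
    degree≤ : length neighbours ≤ suc w
    degree≤ = ≤-pred (≤-trans (Unique⇒length≤∣∣ (bag node) (vertex≢neighbours ∷ unique)
                                                 (vertex∈bag ∷ All.map neighbours∈bag adjacent))
                              (bag-size node))
    neighbour∈V′ : ∀ {u} → u ∈ neighbours → u ∈ V′
    neighbour∈V′ u∈ with All.lookup adjacent u∈
    ... | inj₁ vu∈E = ∈-↭∷⁻ V↭ (proj₂ (I.ends∈V vu∈E)) (≢-sym (All.lookup vertex≢neighbours u∈))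
    ... | inj₂ uv∈E = ∈-↭∷⁻ V↭ (proj₁ (I.ends∈V uv∈E)) (≢-sym (All.lookup vertex≢neighbours u∈))
    module R = Simplification
                 (simplify {s = s} {t} {suc w} {V′} rest (pairs neighbours) ↭-refl
                           (SimpleGraph-++⁻ʳ spokes (SimpleGraph-resp-↭ split I.simple))
                           (pairs-loopless unique))
    rest⊆E : ∀ {e} → e ∈ rest → e ∈ E
    rest⊆E = ∈-resp-↭ (↭-sym split) ∘ ∈-++⁺ʳ spokes
    ends∈V′ : ∀ {e} → e ∈ R.edges′ → proj₁ e ∈ V′ × proj₂ e ∈ V′
    ends∈V′ e∈ with ∈-++⁻ rest (R.⊆-edges e∈)
    ... | inj₁ e∈rest = let x∈ , y∈ = I.ends∈V (rest⊆E e∈rest) ; x≢ , y≢ = All.lookup rest-avoids e∈rest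
                        in ∈-↭∷⁻ V↭ x∈ x≢ , ∈-↭∷⁻ V↭ y∈ y≢
    ... | inj₂ e∈mesh = let x∈ , y∈ = ∈-pairs⁻ neighbours e∈mesh in neighbour∈V′ x∈ , neighbour∈V′ y∈
    edge-covered′ : ∀ {x y} → (x , y) ∈ R.edges′ → ∃ λ k → k ∈ A × x Sub.∈ bag k × y Sub.∈ bag k
    edge-covered′ e∈ with ∈-++⁻ rest (R.⊆-edges e∈)
    ... | inj₁ e∈rest = D.edge-covered (rest⊆E e∈rest)
    ... | inj₂ e∈mesh = let x∈ , y∈ = ∈-pairs⁻ neighbours e∈mesh
                        in node , node∈A , neighbours∈bag (All.lookup adjacent x∈) , neighbours∈bag (All.lookup adjacent y∈)

  terminal-state : ∀ {V E} → Invariant V E → (∀ {c} → c ∈ V → c ≡ s ⊎ c ≡ t) → Reducible s t w V E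
  terminal-state {V} {E} I terminal =
    mkState V E , 0 , 0 , done , V↭st , at-most-one-edge (proj₂ simple) (All.tabulate joins-s-t) , z≤n , z≤n
    where
    open Invariant I
    V↭st : V ↭ s ∷ t ∷ []
    V↭st with V₁ , V↭ ← ∈-∃↭ s∈V with V₂ , V₁↭ ← ∈-∃↭ (∈-↭∷⁻ V↭ t∈V (≢-sym s≢t)) with V₂
    ... | []    = ↭-trans V↭ (↭-prep s V₁↭)
    ... | x ∷ _ with x∈V₁ ← ∈-resp-↭ (↭-sym V₁↭) (there (here refl))
                with terminal (∈-resp-↭ (↭-sym V↭) (there x∈V₁))
    ...   | inj₁ refl = ⊥-elim (∉-↭∷ unique V↭ x∈V₁)
    ...   | inj₂ refl = ⊥-elim (∉-↭∷ (Unique-↭∷ unique V↭) V₁↭ (here refl))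
    joins-s-t : ∀ {e} → e ∈ E → SameEnds e (s , t)
    joins-s-t e∈ with terminal (proj₁ (ends∈V e∈)) | terminal (proj₂ (ends∈V e∈)) | All.lookup (proj₁ simple) e∈
    ... | inj₁ refl | inj₁ refl | loopless = ⊥-elim (loopless refl)
    ... | inj₁ refl | inj₂ refl | _        = inj₁ (refl , refl)
    ... | inj₂ refl | inj₁ refl | _        = inj₂ (refl , refl)
    ... | inj₂ refl | inj₂ refl | loopless = ⊥-elim (loopless refl)

  prepend-elimination : ∀ {V E V′ E′ p₁} → Reduction s t (suc w) (mkState V E) (mkState V′ E′) p₁ 1 →
                        p₁ ≤ w * suc w → suc (length V′) ≡ length V → Reducible s t w V′ E′ → Reducible s t w V E
  prepend-elimination {V} {V′ = V′} {p₁ = p₁} r p₁≤ one-fewer (F , p , q , r′ , F-alive , F-edges , p≤ , q≤) =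
    F , p₁ + p , suc q , r ++ᴿ r′ , F-alive , F-edges , p₁+p≤ , subst (suc q ≤_) one-fewer (s≤s q≤)
    where
    open ≤-Reasoning
    distrib : ∀ x k → 2 * x + 2 * (x * k) ≡ 2 * (x * suc k)
    distrib = solve-∀
    p₁+p≤ : p₁ + p ≤ 2 * (w ^ 2 * length V)
    p₁+p≤ = begin
      p₁ + p                                ≤⟨ +-mono-≤ (≤-trans p₁≤ (w*[1+w]≤2*w² w)) p≤ ⟩
      2 * w ^ 2 + 2 * (w ^ 2 * length V′)   ≡⟨ distrib (w ^ 2) (length V′) ⟩
      2 * (w ^ 2 * suc (length V′))         ≡⟨ cong (λ k → 2 * (w ^ 2 * k)) one-fewer ⟩
      2 * (w ^ 2 * length V)                ∎

  reduce : ∀ fuel {V E A TE} → length V + length A ≤ fuel → Invariant V E → Decomposition V E A TE → Reducible s t w V E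
  reduce zero {[]}    _  I _ with () ← Invariant.s∈V I
  reduce zero {_ ∷ _} () _ _
  reduce (suc fuel) {V} {A = A} bound I D with any? (λ c → ¬? ((c ≟ s) ⊎-dec (c ≟ t))) V
  ... | no ¬some = terminal-state I λ {c} c∈V → decidable-stable ((c ≟ s) ⊎-dec (c ≟ t)) (¬some ∘ lose c∈V)
  ... | yes some with c , c∈V , c∉st ← find some with eliminable-or-shrinking A I D c∈V (c∉st ∘ inj₁) (c∉st ∘ inj₂)
  ...   | inj₂ shrinking = reduce fuel (≤-pred (<-≤-trans (+-monoʳ-< (length V) fewer-nodes) bound)) I decomposition′
    where open Shrinking shrinking
  ...   | inj₁ eliminable = prepend-elimination reduction steps≤ one-fewer
            (reduce fuel (≤-pred (≤-trans (≤-reflexive (cong (_+ length A) one-fewer)) bound)) invariant decomposition)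
    where open Eliminated (eliminate I D eliminable)

reducible : ∀ {n w} {E : List (Edge n)} → SimpleGraph E → TreewidthAtMost n E w →
            ∀ s t → s ≢ t → Reducible s t w (allFin n) E
reducible {n} {w} {E} simple (D , width) s t s≢t =
  reduce (length (allFin n) + length (allFin m)) ≤-refl invariant decomposition
  where
  open TreeDecomposition D
  bag′ : Fin m → Subset n
  bag′ k = ⁅ s ⁆ ∪ bag k
  bag′-size : ∀ k → Sub.∣ bag′ k ∣ ≤ 2 + w
  bag′-size k = ≤-trans (∣p∪q∣≤∣p∣+∣q∣ ⁅ s ⁆ (bag k))
                        (≤-trans (≤-reflexive (cong (_+ Sub.∣ bag k ∣) (Subₚ.∣⁅x⁆∣≡1 s))) (s≤s (width k)))
  s∈bag′ : ∀ k → s Sub.∈ bag′ k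
  s∈bag′ k = Subₚ.x∈p∪q⁺ (inj₁ (Subₚ.x∈⁅x⁆ s))
  ⊆bag′ : ∀ {v k} → v Sub.∈ bag k → v Sub.∈ bag′ k
  ⊆bag′ v∈ = Subₚ.x∈p∪q⁺ (inj₂ v∈)
  open Elimination s t s≢t w bag′ bag′-size s∈bag′
  subtree-connected′ : ∀ {v i j} → v Sub.∈ bag′ i → v Sub.∈ bag′ j → WalkIn treeEdges (λ k → v Sub.∈ bag′ k) i j
  subtree-connected′ {v} {i} {j} v∈i v∈j with v ≟ s
  ... | yes refl = WalkIn-map (λ _ → s∈bag′ _) (proj₁ (proj₂ isTree) i j)
  ... | no v≢s   = WalkIn-map ⊆bag′ (subtreeConnected v i j (from-bag′ v∈i) (from-bag′ v∈j))
    where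
    from-bag′ : ∀ {k} → v Sub.∈ bag′ k → v Sub.∈ bag k
    from-bag′ {k} v∈ with Subₚ.x∈p∪q⁻ ⁅ s ⁆ (bag k) v∈
    ... | inj₁ v∈⁅s⁆ = ⊥-elim (v≢s (Subₚ.x∈⁅y⁆⇒x≡y s v∈⁅s⁆))
    ... | inj₂ v∈bag = v∈bag
  invariant : Invariant (allFin n) E
  invariant = record
    { unique = allFin⁺ n ; s∈V = ∈-allFin s ; t∈V = ∈-allFin t
    ; ends∈V = λ _ → ∈-allFin _ , ∈-allFin _ ; simple = simple }
  decomposition : Decomposition (allFin n) E (allFin m) treeEdges
  decomposition = record
    { nodes-unique = allFin⁺ m ; tree-ends = λ _ → ∈-allFin _ , ∈-allFin _
    ; tree-size = ≡.trans (proj₂ (proj₂ isTree)) (sym (length-tabulate {n = m} (λ k → k)))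
    ; tree-connected = λ {a} {b} _ _ → proj₁ (proj₂ isTree) a b
    ; vertex-covered = λ {v} _ → let k , v∈k = vertexCovered v in k , ∈-allFin k , ⊆bag′ v∈k
    ; edge-covered = λ uv∈E → let k , u∈k , v∈k = edgeCovered uv∈E in k , ∈-allFin k , ⊆bag′ u∈k , ⊆bag′ v∈k
    ; subtree-connected = λ _ _ _ → subtree-connected′ }

theorem5 : ∃ λ (C₁ : ℕ) → ∃ λ (C₂ : ℕ) →
    ∀ (n w : ℕ) (E : List (Edge n)) → SimpleGraph E → TreewidthAtMost n E w →
    (s t : Fin n) → s ≢ t →
    ∃ λ (F : State n) → ∃ λ (p : ℕ) → ∃ λ (q : ℕ) →
      Reduction s t (suc w) (mkState (allFin n) E) F p q ×
      alive F ↭ (s ∷ t ∷ []) × length (edges F) ≤ 1 ×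
      p ≤ C₁ * (w ^ 2 * n) × q ≤ C₂ * n
theorem5 = 2 , 1 , λ n w E simple tw s t s≢t →
  let F , p , q , reduction , F-alive , F-edges , p≤ , q≤ = reducible simple tw s t s≢t
      |V|≡n = length-tabulate {n = n} (λ v → v)
  in F , p , q , reduction , F-alive , F-edges , subst (λ k → p ≤ 2 * (w ^ 2 * k)) |V|≡n p≤
   , subst (q ≤_) (sym (*-identityˡ n)) (subst (q ≤_) |V|≡n q≤)
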